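{- Let $\mathcal{C}\subseteq\mathbb{Z}_2^\alpha\times\mathbb{Z}_4^\beta$ be a $\mathbb{Z}_2\mathbb{Z}_4$-additive code such that $\Phi(\mathcal{C})$ is $\mathbb{Z}_2$-linear. Then $\theta(\mathcal{C})\subseteq\mathbb{Z}_2^\alpha\times\mathbb{Z}_2[u]^\beta$ is a $\mathbb{Z}_2\mathbb{Z}_2[u]$-additive code.
   Context: A $\mathbb{Z}_2\mathbb{Z}_4$-additive code with parameters $(\alpha,\beta)$ is an additive subgroup of $\mathbb{Z}_2^\alpha\times\mathbb{Z}_4^\beta$. The Gray map $\phi:\mathbb{Z}_4\to\mathbb{Z}_2^2$ is $\phi(0)=(0,0)$, $\phi(1)=(0,1)$, $\phi(2)=(1,1)$, $\phi(3)=(1,0)$, extended coordinatewise, and $\Phi(x\mid x')=(x\mid\phi(x'))\in\mathbb{Z}_2^{\alpha+2\beta}$. Let $\mathbb{Z}_2[u]=\{0,1,u,1+u\}$ be the ring with $u^2=0$, and $\pi:\mathbb{Z}_2[u]\to\mathbb{Z}_2$ with $\pi(0)=\pi(u)=0$, $\pi(1)=\pi(1+u)=1$. $\mathbb{Z}_2^\alpha\times\mathbb{Z}_2[u]^\beta$ is a $\mathbb{Z}_2[u]$-module with componentwise addition and scalar multiplication $\lambda(x_1,\dots,x_\alpha\mid x'_1,\dots,x'_\beta)=(\pi(\lambda)x_1,\dots,\pi(\lambda)x_\alpha\mid\lambda x'_1,\dots,\lambda x'_\beta)$; a $\mathbb{Z}_2\mathbb{Z}_2[u]$-additive code is a $\mathbb{Z}_2[u]$-submodule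 of it. The map $\theta:\mathbb{Z}_2^\alpha\times\mathbb{Z}_4^\beta\to\mathbb{Z}_2^\alpha\times\mathbb{Z}_2[u]^\beta$ is $\theta(x_1,\dots,x_\alpha\mid y_1,\dots,y_\beta)=(x_1,\dots,x_\alpha\mid\vartheta(y_1),\dots,\vartheta(y_\beta))$ with $\vartheta(0)=0$, $\vartheta(1)=1$, $\vartheta(2)=u$, $\vartheta(3)=1+u$. -}

module Defs where

open import Data.Bool using (Bool; true; false; _xor_; _∧_)
open import Data.Nat using (ℕ; _+_; _*_)
open import Data.Vec using (Vec; []; _∷_; _++_; concat; map; zipWith; replicate)
open import Data.Product using (_×_; _,_; ∃)
open import Relation.Binary.PropositionalEquality using (_≡_)

-- ℤ₂ is modelled by Bool (false = 0, true = 1, addition = xor).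

data Z4 : Set where
  z0 z1 z2 z3 : Z4

_+4_ : Z4 → Z4 → Z4
z0 +4 y = y
z1 +4 z0 = z1
z1 +4 z1 = z2
z1 +4 z2 = z3
z1 +4 z3 = z0
z2 +4 z0 = z2
z2 +4 z1 = z3
z2 +4 z2 = z0
z2 +4 z3 = z1
z3 +4 z0 = z3
z3 +4 z1 = z0
z3 +4 z2 = z1
z3 +4 z3 = z2

neg4 : Z4 → Z4
neg4 z0 = z0
neg4 z1 = z3
neg4 z2 = z2
neg4 z3 = z1

-- ℤ₂[u] = {0, 1, u, 1+u}, u² = 0
data Z2u : Set where
  u0 u1 uu u1u : Z2u

-- a + b·u  represented by its two bits
toBits : Z2u → Bool × Bool
toBits u0 = false , false
toBits u1 = true , false
toBits uu = false , true
toBits u1u = true , true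

fromBits : Bool × Bool → Z2u
fromBits (false , false) = u0
fromBits (true , false) = u1
fromBits (false , true) = uu
fromBits (true , true) = u1u

_+u_ : Z2u → Z2u → Z2u
x +u y with toBits x | toBits y
... | (a , b) | (c , d) = fromBits (a xor c , b xor d)

-- (a + b u)(c + d u) = ac + (ad + bc) u
_*u_ : Z2u → Z2u → Z2u
x *u y with toBits x | toBits y
... | (a , b) | (c , d) = fromBits (a ∧ c , (a ∧ d) xor (b ∧ c))

π : Z2u → Bool
π u0 = false
π u1 = true
π uu = false
π u1u = true

Z2Z4 : ℕ → ℕ → Set
Z2Z4 α β = Vec Bool α × Vec Z4 β

Z2Z2u : ℕ → ℕ → Set
Z2Z2u α β = Vec Bool α × Vec Z2u β

Code : Set → Set₁
Code A = A → Set

zero24 : ∀ {α β} → Z2Z4 α β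
zero24 = replicate _ false , replicate _ z0

_⊕24_ : ∀ {α β} → Z2Z4 α β → Z2Z4 α β → Z2Z4 α β
(x , y) ⊕24 (x' , y') = zipWith _xor_ x x' , zipWith _+4_ y y'

neg24 : ∀ {α β} → Z2Z4 α β → Z2Z4 α β
neg24 (x , y) = x , map neg4 y

record IsZ2Z4Additive {α β} (C : Code (Z2Z4 α β)) : Set where
  field
    has-zero : C zero24
    add-closed : ∀ a b → C a → C b → C (a ⊕24 b)
    neg-closed : ∀ a → C a → C (neg24 a)

φ : Z4 → Vec Bool 2
φ z0 = false ∷ false ∷ []
φ z1 = false ∷ true ∷ []
φ z2 = true ∷ true ∷ []
φ z3 = true ∷ false ∷ []

Φ : ∀ {α β} → Z2Z4 α β → Vec Bool (α + β * 2)
Φ (x , y) = x ++ concat (map φ y)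

Image : ∀ {A B : Set} → (A → B) → Code A → Code B
Image f C b = ∃ λ a → C a × f a ≡ b

record IsZ2Linear {n} (D : Code (Vec Bool n)) : Set where
  field
    has-zero : D (replicate n false)
    add-closed : ∀ a b → D a → D b → D (zipWith _xor_ a b)
    scal-closed : ∀ (λ' : Bool) a → D a → D (map (λ' ∧_) a)

zero2u : ∀ {α β} → Z2Z2u α β
zero2u = replicate _ false , replicate _ u0

_⊕2u_ : ∀ {α β} → Z2Z2u α β → Z2Z2u α β → Z2Z2u α β
(x , y) ⊕2u (x' , y') = zipWith _xor_ x x' , zipWith _+u_ y y'

_·2u_ : ∀ {α β} → Z2u → Z2Z2u α β → Z2Z2u α β
λ' ·2u (x , y) = map (π λ' ∧_) x , map (λ' *u_) y

record IsZ2Z2uAdditive {α β} (D : Code (Z2Z2u α β)) : Set where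
  field
    has-zero : D zero2u
    add-closed : ∀ a b → D a → D b → D (a ⊕2u b)
    scal-closed : ∀ (λ' : Z2u) a → D a → D (λ' ·2u a)

ϑ : Z4 → Z2u
ϑ z0 = u0
ϑ z1 = u1
ϑ z2 = uu
ϑ z3 = u1u

θ : ∀ {α β} → Z2Z4 α β → Z2Z2u α β
θ (x , y) = x , map ϑ y

-- The Gray map factors through θ: Φ = Γ ∘ θ, where Γ applies on every ℤ₂[u]-coordinate the
-- Gray map γ(a + bu) = (b, a + b) of ℤ₂[u].  Since γ is an injective homomorphism
-- (ℤ₂[u], +) → ℤ₂², a sum Φ a + Φ b = Φ c inside the linear code Φ(C) forces
-- θ a + θ b = θ c, so θ(C) is closed under addition.  For scalars, ϑ is multiplicative, so
-- θ (k · c) = ϑ k · θ c, and an additive subgroup of ℤ₂^α × ℤ₄^β is closed under ℤ₄-scalars.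
module Submission where

open import Data.Bool using (Bool; true; false; _xor_; _∧_)
open import Data.Bool.Properties using (xor-same)
open import Data.Nat using (ℕ; _+_; _*_)
open import Data.Product using (_,_)
open import Data.Vec using (Vec; []; _∷_; _++_; concat; map; zipWith; replicate)
open import Data.Vec.Properties
  using (map-id; map-const; map-cong; map-∘; map-replicate; zipWith-++; ++-injective)
open import Function using (_∘_)
open import Function.Definitions using (Injective)
open import Relation.Binary.PropositionalEquality
  using (_≡_; refl; sym; trans; cong; cong₂; subst; module ≡-Reasoning)

open import Defs

private
  variable
    A B : Set
    m n : ℕ

zipWith-diagonal : (f : A → A → B) (xs : Vec A n) → zipWith f xs xs ≡ map (λ x → f x x) xs
zipWith-diagonal f []       = refl
zipWith-diagonal f (x ∷ xs) = cong (f x x ∷_) (zipWith-diagonal f xs)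

concat-map-zipWith : (h : A → Vec B m) {f : A → A → A} {g : B → B → B} →
  (∀ a b → h (f a b) ≡ zipWith g (h a) (h b)) →
  (xs ys : Vec A n) →
  concat (map h (zipWith f xs ys)) ≡ zipWith g (concat (map h xs)) (concat (map h ys))
concat-map-zipWith h h-hom []       []       = refl
concat-map-zipWith h {f} {g} h-hom (x ∷ xs) (y ∷ ys) = begin
  h (f x y) ++ concat (map h (zipWith f xs ys))
    ≡⟨ cong₂ _++_ (h-hom x y) (concat-map-zipWith h h-hom xs ys) ⟩
  zipWith g (h x) (h y) ++ zipWith g (concat (map h xs)) (concat (map h ys))
    ≡⟨ sym (zipWith-++ g (h x) _ (h y) _) ⟩
  zipWith g (h x ++ concat (map h xs)) (h y ++ concat (map h ys))
    ∎
  where open ≡-Reasoning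

concat-map-injective : {h : A → Vec B m} → Injective _≡_ _≡_ h →
  Injective _≡_ _≡_ (λ (xs : Vec A n) → concat (map h xs))
concat-map-injective h-inj {[]}     {[]}     _  = refl
concat-map-injective h-inj {x ∷ xs} {y ∷ ys} eq =
  let x≡y , xs≡ys = ++-injective _ _ eq
  in cong₂ _∷_ (h-inj x≡y) (concat-map-injective h-inj xs≡ys)

γ : Z2u → Vec Bool 2
γ u0  = false ∷ false ∷ []
γ u1  = false ∷ true  ∷ []
γ uu  = true  ∷ true  ∷ []
γ u1u = true  ∷ false ∷ []

γ⁻¹ : Vec Bool 2 → Z2u
γ⁻¹ (b ∷ c ∷ []) = fromBits (b xor c , b)

γ⁻¹-γ : ∀ x → γ⁻¹ (γ x) ≡ x
γ⁻¹-γ u0  = refl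
γ⁻¹-γ u1  = refl
γ⁻¹-γ uu  = refl
γ⁻¹-γ u1u = refl

γ-injective : Injective _≡_ _≡_ γ
γ-injective {x} {y} eq = begin
  x          ≡⟨ sym (γ⁻¹-γ x) ⟩
  γ⁻¹ (γ x)  ≡⟨ cong γ⁻¹ eq ⟩
  γ⁻¹ (γ y)  ≡⟨ γ⁻¹-γ y ⟩
  y          ∎
  where open ≡-Reasoning

γ-+u : ∀ x y → γ (x +u y) ≡ zipWith _xor_ (γ x) (γ y)
γ-+u u0  u0  = refl
γ-+u u0  u1  = refl
γ-+u u0  uu  = refl
γ-+u u0  u1u = refl
γ-+u u1  u0  = refl
γ-+u u1  u1  = refl
γ-+u u1  uu  = refl
γ-+u u1  u1u = refl
γ-+u uu  u0  = refl
γ-+u uu  u1  = refl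
γ-+u uu  uu  = refl
γ-+u uu  u1u = refl
γ-+u u1u u0  = refl
γ-+u u1u u1  = refl
γ-+u u1u uu  = refl
γ-+u u1u u1u = refl

φ≡γ∘ϑ : ∀ z → φ z ≡ γ (ϑ z)
φ≡γ∘ϑ z0 = refl
φ≡γ∘ϑ z1 = refl
φ≡γ∘ϑ z2 = refl
φ≡γ∘ϑ z3 = refl

Γ : ∀ {α β} → Z2Z2u α β → Vec Bool (α + β * 2)
Γ (x , y) = x ++ concat (map γ y)

Φ≡Γ∘θ : ∀ {α β} (a : Z2Z4 α β) → Φ a ≡ Γ (θ a)
Φ≡Γ∘θ (x , y) = cong (λ v → x ++ concat v) (trans (map-cong φ≡γ∘ϑ y) (map-∘ γ ϑ y))

Γ-⊕2u : ∀ {α β} (p q : Z2Z2u α β) → Γ (p ⊕2u q) ≡ zipWith _xor_ (Γ p) (Γ q)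
Γ-⊕2u (x , y) (x' , y') = trans
  (cong (zipWith _xor_ x x' ++_) (concat-map-zipWith γ γ-+u y y'))
  (sym (zipWith-++ _xor_ x _ x' _))

Γ-injective : ∀ {α β} → Injective _≡_ _≡_ (Γ {α} {β})
Γ-injective {x = x , y} {x' , y'} eq =
  let x≡x' , rest = ++-injective x x' eq
  in cong₂ _,_ x≡x' (concat-map-injective γ-injective rest)

θ-⊕2u : ∀ {α β} (a b c : Z2Z4 α β) →
  Φ c ≡ zipWith _xor_ (Φ a) (Φ b) → θ c ≡ θ a ⊕2u θ b
θ-⊕2u a b c Φc≡Φa+Φb = Γ-injective (begin
  Γ (θ c)                               ≡⟨ sym (Φ≡Γ∘θ c) ⟩
  Φ c                                   ≡⟨ Φc≡Φa+Φb ⟩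
  zipWith _xor_ (Φ a) (Φ b)             ≡⟨ cong₂ (zipWith _xor_) (Φ≡Γ∘θ a) (Φ≡Γ∘θ b) ⟩
  zipWith _xor_ (Γ (θ a)) (Γ (θ b))     ≡⟨ sym (Γ-⊕2u (θ a) (θ b)) ⟩
  Γ (θ a ⊕2u θ b)                       ∎)
  where open ≡-Reasoning

_*4_ : Z4 → Z4 → Z4
z0 *4 _ = z0
z1 *4 y = y
z2 *4 y = y +4 y
z3 *4 y = neg4 y

mod2 : Z4 → Bool
mod2 z0 = false
mod2 z1 = true
mod2 z2 = false
mod2 z3 = true

_·24_ : ∀ {α β} → Z4 → Z2Z4 α β → Z2Z4 α β
k ·24 (x , y) = map (mod2 k ∧_) x , map (k *4_) y

·24-closed : ∀ {α β} {C : Code (Z2Z4 α β)} → IsZ2Z4Additive C →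
  ∀ k a → C a → C (k ·24 a)
·24-closed {C = C} additive z0 (x , y) _ =
  subst C (sym (cong₂ _,_ (map-const x false) (map-const y z0))) has-zero
  where open IsZ2Z4Additive additive
·24-closed {C = C} additive z1 (x , y) a∈C =
  subst C (sym (cong₂ _,_ (map-id x) (map-id y))) a∈C
·24-closed {C = C} additive z2 a@(x , y) a∈C =
  subst C (cong₂ _,_ x⊕x≡0 (zipWith-diagonal _+4_ y)) (add-closed a a a∈C a∈C)
  where
  open IsZ2Z4Additive additive
  x⊕x≡0 : zipWith _xor_ x x ≡ map (false ∧_) x
  x⊕x≡0 = trans (zipWith-diagonal _xor_ x) (map-cong xor-same x)
·24-closed {C = C} additive z3 a@(x , y) a∈C =
  subst C (cong (_, map neg4 y) (sym (map-id x))) (neg-closed a a∈C)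
  where open IsZ2Z4Additive additive

ϑ-*4 : ∀ k z → ϑ (k *4 z) ≡ ϑ k *u ϑ z
ϑ-*4 z0 z0 = refl
ϑ-*4 z0 z1 = refl
ϑ-*4 z0 z2 = refl
ϑ-*4 z0 z3 = refl
ϑ-*4 z1 z0 = refl
ϑ-*4 z1 z1 = refl
ϑ-*4 z1 z2 = refl
ϑ-*4 z1 z3 = refl
ϑ-*4 z2 z0 = refl
ϑ-*4 z2 z1 = refl
ϑ-*4 z2 z2 = refl
ϑ-*4 z2 z3 = refl
ϑ-*4 z3 z0 = refl
ϑ-*4 z3 z1 = refl
ϑ-*4 z3 z2 = refl
ϑ-*4 z3 z3 = refl

π∘ϑ≡mod2 : ∀ k → π (ϑ k) ≡ mod2 k
π∘ϑ≡mod2 z0 = refl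
π∘ϑ≡mod2 z1 = refl
π∘ϑ≡mod2 z2 = refl
π∘ϑ≡mod2 z3 = refl

θ-·24 : ∀ {α β} k (a : Z2Z4 α β) → θ (k ·24 a) ≡ ϑ k ·2u θ a
θ-·24 k (x , y) = cong₂ _,_
  (cong (λ b → map (b ∧_) x) (sym (π∘ϑ≡mod2 k)))
  (begin
    map ϑ (map (k *4_) y)          ≡⟨ sym (map-∘ ϑ (k *4_) y) ⟩
    map (ϑ ∘ (k *4_)) y            ≡⟨ map-cong (ϑ-*4 k) y ⟩
    map ((ϑ k *u_) ∘ ϑ) y          ≡⟨ map-∘ (ϑ k *u_) ϑ y ⟩
    map (ϑ k *u_) (map ϑ y)        ∎)
  where open ≡-Reasoning

ϑ⁻¹ : Z2u → Z4
ϑ⁻¹ u0  = z0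
ϑ⁻¹ u1  = z1
ϑ⁻¹ uu  = z2
ϑ⁻¹ u1u = z3

ϑ-ϑ⁻¹ : ∀ l → ϑ (ϑ⁻¹ l) ≡ l
ϑ-ϑ⁻¹ u0  = refl
ϑ-ϑ⁻¹ u1  = refl
ϑ-ϑ⁻¹ uu  = refl
ϑ-ϑ⁻¹ u1u = refl

θ-zero24 : ∀ {α β} → θ (zero24 {α} {β}) ≡ zero2u
θ-zero24 {α} {β} = cong (replicate α false ,_) (map-replicate ϑ z0 β)

theorem3 : (α β : ℕ) (C : Code (Z2Z4 α β)) →
    IsZ2Z4Additive C →
    IsZ2Linear (Image (Φ {α} {β}) C) →
    IsZ2Z2uAdditive (Image (θ {α} {β}) C)
theorem3 α β C additive linear = record
  { has-zero    = zero24 , has-zero , θ-zero24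
  ; add-closed  = θ-add-closed
  ; scal-closed = θ-scal-closed
  }
  where
  open IsZ2Z4Additive additive

  θ-add-closed : ∀ p q → Image θ C p → Image θ C q → Image θ C (p ⊕2u q)
  θ-add-closed _ _ (a , a∈C , refl) (b , b∈C , refl) =
    let c , c∈C , Φc≡Φa+Φb = IsZ2Linear.add-closed linear _ _ (a , a∈C , refl) (b , b∈C , refl)
    in c , c∈C , θ-⊕2u a b c Φc≡Φa+Φb

  θ-scal-closed : ∀ l p → Image θ C p → Image θ C (l ·2u p)
  θ-scal-closed l _ (a , a∈C , refl) =
    ϑ⁻¹ l ·24 a , ·24-closed additive (ϑ⁻¹ l) a a∈C ,
    trans (θ-·24 (ϑ⁻¹ l) a) (cong (_·2u θ a) (ϑ-ϑ⁻¹ l))
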